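{- Let $m\ge1$, let $d_1,\dots,d_m$ be positive integers, and put $\xi=\frac12\sum_{i=1}^m d_i$. Define $V(s,{\bf d}^m)=\widetilde W(s-\xi,{\bf d}^m)$ for $s\in \xi+\mathbb{Z}$. Then for all $s\in\xi+\mathbb{Z}$: if $m$ is even, $V(s,{\bf d}^m)=-V(-s,{\bf d}^m)$; if $m$ is odd, $V(s,{\bf d}^m)=V(-s,{\bf d}^m)$.
   Context: For an integer $s\ge0$, $W(s,{\bf d}^m)$ is the coefficient of $t^s$ in $\prod_{r=1}^m(1-t^{d_r})^{ -1}$, i.e. the number of nonnegative integer solutions of $d_1x_1+\dots+d_mx_m=s$. There is a unique function $\widetilde W(\cdot,{\bf d}^m):\mathbb{Z}\to\mathbb{Q}$ of the form $\widetilde W(s,{\bf d}^m)=\sum_{i=0}^{m-1}c_i(s)s^i$ with each $c_i:\mathbb Z\to\mathbb Q$ periodic (a quasi-polynomial) that agrees with $W(s,{\bf d}^m)$ for all integers $s\ge 0$. Note $-s\in\xi+\mathbb Z$ whenever $s\in\xi+\mathbb Z$, since $2\xi\in\mathbb Z$. -}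

module Defs where

open import Data.Nat as ℕ using (ℕ; zero; suc; _≤ᵇ_)
open import Data.Integer as ℤ using (ℤ; +_)
open import Data.Rational as ℚ using (ℚ; 0ℚ; 1ℚ; _*_; _+_; _/_)
open import Data.Fin using (Fin; toℕ)
open import Data.Nat.ListAction using (sum)
open import Data.Vec using (Vec; []; _∷_)
open import Data.List using (List; map; upTo)
open import Data.Bool using (if_then_else_)
open import Relation.Binary.PropositionalEquality using (_≡_)
open import Data.Product using (Σ; _×_)

-- W(s, d) : number of nonnegative integer solutions (x_1..x_m) of
-- d_1 x_1 + ... + d_m x_m = s, computed by recursion on the first variable
-- (x_1 ranges over 0..s, only those with d_1 x_1 ≤ s contribute).
W : ∀ {m} → Vec ℕ m → ℕ → ℕ
W [] s = if s ℕ.≡ᵇ 0 then 1 else 0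
W (d ∷ ds) s =
  sum (map (λ x → if d ℕ.* x ≤ᵇ s then W ds (s ℕ.∸ d ℕ.* x) else 0) (upTo (suc s)))

vsum : ∀ {m} → Vec ℕ m → ℕ
vsum [] = 0
vsum (d ∷ ds) = d ℕ.+ vsum ds

fromℤ : ℤ → ℚ
fromℤ z = z / 1

_^_ : ℚ → ℕ → ℚ
q ^ zero = 1ℚ
q ^ suc n = q * (q ^ n)

ΣFin : ∀ m → (Fin m → ℚ) → ℚ
ΣFin zero f = 0ℚ
ΣFin (suc m) f = f Fin.zero + ΣFin m (λ i → f (Fin.suc i))

Periodic : (ℤ → ℚ) → Set
Periodic c = Σ ℕ λ N → (N ℕ.> 0) × (∀ s → c (s ℤ.+ + N) ≡ c s)

IsQuasiPoly : ℕ → (ℤ → ℚ) → Set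
IsQuasiPoly m f = Σ (Fin m → ℤ → ℚ) λ c →
  ((i : Fin m) → Periodic (c i)) × (∀ s → f s ≡ ΣFin m (λ i → c i s * (fromℤ s ^ toℕ i)))

IsWtilde : ∀ {m} → Vec ℕ m → (ℤ → ℚ) → Set
IsWtilde {m} d f = IsQuasiPoly m f × (∀ (s : ℕ) → f (+ s) ≡ fromℤ (+ W d s))

ξ : ∀ {m} → Vec ℕ m → ℚ
ξ d = (+ vsum d) / 2

{-# OPTIONS --safe #-}
module Submission where

-- Write Δ c f (s) = f s - f (s - c) and Δᵥ d for the composite of Δ d₁, …, Δ dₘ, the operator
-- ∏ (1 - T^dᵢ) inverse to the generating function of W. Extending W by zero to s < 0 gives W₀
-- with Δᵥ d W₀ = δ, the indicator of 0. The Δ's commute, and a quasi-polynomial of degree < m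
-- with common period N is killed by (Δ N)^m. A function killed by Δᵥ e, all eᵢ > 0, that
-- vanishes far to the right vanishes everywhere. With e = (N, …, N) this gives Δᵥ d W̃ = 0, as
-- Δᵥ d W̃ equals δ far to the right; with e = d it gives W̃(s) = W₀(s) - (-1)^m W₀(-Σd - s), as
-- both sides are killed by Δᵥ d and agree for s > 0. This formula gives the reciprocity
-- W̃(s) = -(-1)^m W̃(-Σd - s), and shifting by ξ = Σd/2 turns s ↦ -Σd - s into s ↦ -s.

open import Defs
open import Data.Nat using (ℕ; _≥_; _>_; _*_; _+_)
open import Data.Integer using (ℤ)
open import Data.Rational using (ℚ; -_; _-_)
open import Data.Vec using (Vec)
open import Data.Vec.Relation.Unary.All using (All)
open import Data.Product using (_×_; ∃-syntax)
open import Relation.Binary.PropositionalEquality using (_≡_)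

open import Algebra.Properties.Group using (x∙y⁻¹≈ε⇒x≈y)
open import Data.Bool using (false; if_then_else_)
open import Data.Fin as Fin using (Fin; toℕ)
open import Data.Fin.Properties using (toℕ<n)
open import Data.Integer as ℤ using (+_; -[1+_])
import Data.Integer.Properties as ℤₚ
open import Data.Integer.Tactic.RingSolver using () renaming (ring to ℤ-ring)
open import Data.List using (applyUpTo; tabulate)
open import Data.List.Properties using (map-applyUpTo)
open import Data.List.Membership.Propositional.Properties using (∈-tabulate⁺)
open import Data.List.Relation.Unary.All.Properties using (tabulate⁺)
open import Data.Nat as ℕ
  using (zero; suc; _≤_; _<_; _≤′_; _≤ᵇ_; _∸_; z≤n; s≤s; NonZero; >-nonZero; >-nonZero⁻¹)
open import Data.Nat.Divisibility using (_∣_; divides)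
open import Data.Nat.ListAction using (sum; product)
open import Data.Nat.ListAction.Properties using (∈⇒∣product; product≢0)
import Data.Nat.Properties as ℕₚ
open import Data.Product using (_,_; proj₁; proj₂)
open import Data.Rational as ℚ using (0ℚ; 1ℚ; toℚᵘ)
import Data.Rational.Properties as ℚₚ
open import Data.Rational.Unnormalised as ℚᵘ using (mkℚᵘ; *≡*; _≃_)
import Data.Rational.Unnormalised.Properties as ℚᵘₚ
open import Data.Vec using ([]; _∷_; replicate)
open import Data.Vec.Relation.Unary.All using ([]; _∷_)
open import Function using (_∘_; const)
open import Relation.Binary.PropositionalEquality
  using (refl; sym; trans; cong; cong₂; subst; _≗_; module ≡-Reasoning)
open import Relation.Nullary.Decidable using (yes; no; dec-false; dec⇒maybe)
open import Tactic.RingSolver using (solve-∀)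
open import Tactic.RingSolver.Core.AlmostCommutativeRing
  using (AlmostCommutativeRing; fromCommutativeRing)

ℚ-ring : AlmostCommutativeRing _ _
ℚ-ring = fromCommutativeRing ℚₚ.+-*-commutativeRing (λ p → dec⇒maybe (0ℚ ℚₚ.≟ p))

x-y≡0⇒x≡y : ∀ x y → x - y ≡ 0ℚ → x ≡ y
x-y≡0⇒x≡y = x∙y⁻¹≈ε⇒x≈y ℚₚ.+-0-group

toℚᵘ-/ : ∀ z n → toℚᵘ (z ℚ./ suc n) ≃ mkℚᵘ z n
toℚᵘ-/ z n = ℚₚ.toℚᵘ-fromℚᵘ (mkℚᵘ z n)

fromℤ-injective : ∀ {x y} → fromℤ x ≡ fromℤ y → x ≡ y
fromℤ-injective {x} {y} eq = begin
    x          ≡⟨ ℤₚ.*-identityʳ x ⟨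
    x ℤ.* + 1  ≡⟨ ℚᵘₚ.drop-*≡* x≃y ⟩
    y ℤ.* + 1  ≡⟨ ℤₚ.*-identityʳ y ⟩
    y          ∎
  where
  open ≡-Reasoning
  x≃y : mkℚᵘ x 0 ≃ mkℚᵘ y 0
  x≃y = ℚᵘₚ.≃-trans (ℚᵘₚ.≃-sym (toℚᵘ-/ x 0))
          (ℚᵘₚ.≃-trans (ℚᵘₚ.≃-reflexive (cong toℚᵘ eq)) (toℚᵘ-/ y 0))

fromℤ-+ : ∀ x y → fromℤ (x ℤ.+ y) ≡ fromℤ x ℚ.+ fromℤ y
fromℤ-+ x y = ℚₚ.toℚᵘ-injective (begin
    toℚᵘ (fromℤ (x ℤ.+ y))             ≈⟨ toℚᵘ-/ (x ℤ.+ y) 0 ⟩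
    mkℚᵘ (x ℤ.+ y) 0                   ≈⟨ *≡* (over-1 x y) ⟩
    mkℚᵘ x 0 ℚᵘ.+ mkℚᵘ y 0             ≈⟨ ℚᵘₚ.+-cong (toℚᵘ-/ x 0) (toℚᵘ-/ y 0) ⟨
    toℚᵘ (fromℤ x) ℚᵘ.+ toℚᵘ (fromℤ y) ≈⟨ ℚₚ.toℚᵘ-homo-+ (fromℤ x) (fromℤ y) ⟨
    toℚᵘ (fromℤ x ℚ.+ fromℤ y)         ∎)
  where
  open ℚᵘₚ.≃-Reasoning
  over-1 : ∀ x y → (x ℤ.+ y) ℤ.* (+ 1 ℤ.* + 1) ≡ (x ℤ.* + 1 ℤ.+ y ℤ.* + 1) ℤ.* + 1
  over-1 = solve-∀ ℤ-ring

fromℤ-neg : ∀ x → fromℤ (ℤ.- x) ≡ - fromℤ x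
fromℤ-neg x = ℚₚ.toℚᵘ-injective (begin
    toℚᵘ (fromℤ (ℤ.- x))   ≈⟨ toℚᵘ-/ (ℤ.- x) 0 ⟩
    mkℚᵘ (ℤ.- x) 0         ≈⟨ ℚᵘₚ.-‿cong (toℚᵘ-/ x 0) ⟨
    ℚᵘ.- toℚᵘ (fromℤ x)    ≈⟨ ℚₚ.toℚᵘ-homo‿- (fromℤ x) ⟨
    toℚᵘ (- fromℤ x)       ∎)
  where open ℚᵘₚ.≃-Reasoning

fromℤ-sub : ∀ x y → fromℤ (x ℤ.- y) ≡ fromℤ x - fromℤ y
fromℤ-sub x y = trans (fromℤ-+ x (ℤ.- y)) (cong (fromℤ x ℚ.+_) (fromℤ-neg y))

ξ-double : ∀ {m} (d : Vec ℕ m) → ξ d ℚ.+ ξ d ≡ fromℤ (+ vsum d)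
ξ-double d = ℚₚ.toℚᵘ-injective (begin
    toℚᵘ (ξ d ℚ.+ ξ d)              ≈⟨ ℚₚ.toℚᵘ-homo-+ (ξ d) (ξ d) ⟩
    toℚᵘ (ξ d) ℚᵘ.+ toℚᵘ (ξ d)      ≈⟨ ℚᵘₚ.+-cong (toℚᵘ-/ v 1) (toℚᵘ-/ v 1) ⟩
    mkℚᵘ v 1 ℚᵘ.+ mkℚᵘ v 1          ≈⟨ *≡* (halves v) ⟩
    mkℚᵘ v 0                        ≈⟨ toℚᵘ-/ v 0 ⟨
    toℚᵘ (fromℤ v)                  ∎)
  where
  open ℚᵘₚ.≃-Reasoning
  v = + vsum d
  halves : ∀ x → (x ℤ.* + 2 ℤ.+ x ℤ.* + 2) ℤ.* + 1 ≡ x ℤ.* + 4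
  halves = solve-∀ ℤ-ring

ξ-reflection : ∀ {m} (d : Vec ℕ m) {s k k'} → s - ξ d ≡ fromℤ k → (- s) - ξ d ≡ fromℤ k' →
               k' ≡ (ℤ.- + vsum d) ℤ.- k
ξ-reflection d {s} {k} {k'} s-ξ≡k -s-ξ≡k' = fromℤ-injective (begin
    fromℤ k'                                     ≡⟨ -s-ξ≡k' ⟨
    (- s) - ξ d                                  ≡⟨ regroup s (ξ d) ⟩
    - (ξ d ℚ.+ ξ d) - (s - ξ d)                  ≡⟨ cong₂ (λ x y → - x - y) (ξ-double d) s-ξ≡k ⟩
    - fromℤ (+ vsum d) - fromℤ k                 ≡⟨ cong (_- fromℤ k) (fromℤ-neg (+ vsum d)) ⟨
    fromℤ (ℤ.- + vsum d) - fromℤ k               ≡⟨ fromℤ-sub (ℤ.- + vsum d) k ⟨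
    fromℤ ((ℤ.- + vsum d) ℤ.- k)                 ∎)
  where
  open ≡-Reasoning
  regroup : ∀ s x → (- s) - x ≡ - (x ℚ.+ x) - (s - x)
  regroup = solve-∀ ℚ-ring

sign : ℕ → ℚ
sign zero    = 1ℚ
sign (suc m) = - sign m

sign-+ : ∀ a b → sign (a + b) ≡ sign a ℚ.* sign b
sign-+ zero    b = sym (ℚₚ.*-identityˡ (sign b))
sign-+ (suc a) b = trans (cong -_ (sign-+ a b)) (ℚₚ.neg-distribˡ-* (sign a) (sign b))

sign-sign : ∀ m → sign m ℚ.* sign m ≡ 1ℚ
sign-sign zero    = refl
sign-sign (suc m) = trans (neg*neg (sign m) (sign m)) (sign-sign m)
  where
  neg*neg : ∀ x y → (- x) ℚ.* (- y) ≡ x ℚ.* y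
  neg*neg = solve-∀ ℚ-ring

sign-sign-* : ∀ m x → sign m ℚ.* (sign m ℚ.* x) ≡ x
sign-sign-* m x = begin
    sign m ℚ.* (sign m ℚ.* x)  ≡⟨ ℚₚ.*-assoc (sign m) (sign m) x ⟨
    (sign m ℚ.* sign m) ℚ.* x  ≡⟨ cong (ℚ._* x) (sign-sign m) ⟩
    1ℚ ℚ.* x                   ≡⟨ ℚₚ.*-identityˡ x ⟩
    x                          ∎
  where open ≡-Reasoning

sign-even : ∀ {m} j → m ≡ 2 * j → sign m ≡ 1ℚ
sign-even j refl = begin
    sign (j + (j + 0))      ≡⟨ cong (λ n → sign (j + n)) (ℕₚ.+-identityʳ j) ⟩
    sign (j + j)            ≡⟨ sign-+ j j ⟩
    sign j ℚ.* sign j       ≡⟨ sign-sign j ⟩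
    1ℚ                      ∎
  where open ≡-Reasoning

sign-odd : ∀ {m} j → m ≡ 1 + 2 * j → sign m ≡ - 1ℚ
sign-odd j refl = cong -_ (sign-even j refl)

Δ : ℕ → (ℤ → ℚ) → ℤ → ℚ
Δ d f s = f s - f (s ℤ.- + d)

Δᵥ : ∀ {m} → Vec ℕ m → (ℤ → ℚ) → ℤ → ℚ
Δᵥ []       f = f
Δᵥ (d ∷ ds) f = Δᵥ ds (Δ d f)

Δᵥ-cong : ∀ {m} (e : Vec ℕ m) {f g} → f ≗ g → Δᵥ e f ≗ Δᵥ e g
Δᵥ-cong []       f≗g = f≗g
Δᵥ-cong (d ∷ ds) f≗g = Δᵥ-cong ds (λ s → cong₂ _-_ (f≗g s) (f≗g (s ℤ.- + d)))

Δᵥ-additive : ∀ {m} (e : Vec ℕ m) (φ : ℚ → ℚ) → (∀ a b → φ a - φ b ≡ φ (a - b)) →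
              ∀ f → Δᵥ e (φ ∘ f) ≗ φ ∘ Δᵥ e f
Δᵥ-additive []       φ φ-additive f s = refl
Δᵥ-additive (d ∷ ds) φ φ-additive f s =
  trans (Δᵥ-cong ds (λ u → φ-additive (f u) (f (u ℤ.- + d))) s)
        (Δᵥ-additive ds φ φ-additive (Δ d f) s)

Δᵥ-additive₂ : ∀ {m} (e : Vec ℕ m) (_∙_ : ℚ → ℚ → ℚ) →
               (∀ a b a' b' → (a ∙ b) - (a' ∙ b') ≡ (a - a') ∙ (b - b')) →
               ∀ f g → Δᵥ e (λ s → f s ∙ g s) ≗ λ s → Δᵥ e f s ∙ Δᵥ e g s
Δᵥ-additive₂ []       _∙_ ∙-additive f g s = refl
Δᵥ-additive₂ (d ∷ ds) _∙_ ∙-additive f g s =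
  trans (Δᵥ-cong ds (λ u → ∙-additive (f u) (g u) (f (u ℤ.- + d)) (g (u ℤ.- + d))) s)
        (Δᵥ-additive₂ ds _∙_ ∙-additive (Δ d f) (Δ d g) s)

Δᵥ-+ : ∀ {m} (e : Vec ℕ m) f g → Δᵥ e (λ s → f s ℚ.+ g s) ≗ λ s → Δᵥ e f s ℚ.+ Δᵥ e g s
Δᵥ-+ e = Δᵥ-additive₂ e ℚ._+_ (solve-∀ ℚ-ring)

Δᵥ-sub : ∀ {m} (e : Vec ℕ m) f g → Δᵥ e (λ s → f s - g s) ≗ λ s → Δᵥ e f s - Δᵥ e g s
Δᵥ-sub e = Δᵥ-additive₂ e _-_ (solve-∀ ℚ-ring)

Δᵥ-neg : ∀ {m} (e : Vec ℕ m) f → Δᵥ e (λ s → - f s) ≗ λ s → - Δᵥ e f s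
Δᵥ-neg e = Δᵥ-additive e -_ (solve-∀ ℚ-ring)

Δᵥ-scale : ∀ {m} (e : Vec ℕ m) a f → Δᵥ e (λ s → a ℚ.* f s) ≗ λ s → a ℚ.* Δᵥ e f s
Δᵥ-scale e a = Δᵥ-additive e (a ℚ.*_) (distrib a)
  where
  distrib : ∀ a x y → a ℚ.* x - a ℚ.* y ≡ a ℚ.* (x - y)
  distrib = solve-∀ ℚ-ring

Δᵥ-shift : ∀ {m} (e : Vec ℕ m) c f → Δᵥ e (λ s → f (s ℤ.+ c)) ≗ λ s → Δᵥ e f (s ℤ.+ c)
Δᵥ-shift []       c f s = refl
Δᵥ-shift (d ∷ ds) c f s =
  trans (Δᵥ-cong ds (λ u → cong (λ v → f (u ℤ.+ c) - f v) (shift-comm u (+ d) c)) s)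
        (Δᵥ-shift ds c (Δ d f) s)
  where
  shift-comm : ∀ u d c → (u ℤ.- d) ℤ.+ c ≡ (u ℤ.+ c) ℤ.- d
  shift-comm = solve-∀ ℤ-ring

Δᵥ-Δ : ∀ {m} (e : Vec ℕ m) c f → Δᵥ e (Δ c f) ≗ Δ c (Δᵥ e f)
Δᵥ-Δ e c f s = trans (Δᵥ-sub e f (λ u → f (u ℤ.- + c)) s)
                     (cong (λ x → Δᵥ e f s - x) (Δᵥ-shift e (ℤ.- + c) f s))

Δᵥ-comm : ∀ {m k} (d : Vec ℕ m) (e : Vec ℕ k) f → Δᵥ e (Δᵥ d f) ≗ Δᵥ d (Δᵥ e f)
Δᵥ-comm []       e f s = refl
Δᵥ-comm (c ∷ ds) e f s = trans (Δᵥ-comm ds e (Δ c f) s) (Δᵥ-cong ds (Δᵥ-Δ e c f) s)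

Annihilates : ∀ {m} → Vec ℕ m → (ℤ → ℚ) → Set
Annihilates e f = Δᵥ e f ≗ const 0ℚ

annihilates-cong : ∀ {m} (e : Vec ℕ m) {f g} → f ≗ g → Annihilates e f → Annihilates e g
annihilates-cong e f≗g ann s = trans (Δᵥ-cong e (sym ∘ f≗g) s) (ann s)

annihilates-0 : ∀ {m} (e : Vec ℕ m) → Annihilates e (const 0ℚ)
annihilates-0 []       s = refl
annihilates-0 (d ∷ ds) = annihilates-0 ds

annihilates-+ : ∀ {m} (e : Vec ℕ m) f g → Annihilates e f → Annihilates e g →
                Annihilates e (λ s → f s ℚ.+ g s)
annihilates-+ e f g ann-f ann-g s = trans (Δᵥ-+ e f g s) (cong₂ ℚ._+_ (ann-f s) (ann-g s))

annihilates-scale : ∀ {m} (e : Vec ℕ m) a f → Annihilates e f → Annihilates e (λ s → a ℚ.* f s)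
annihilates-scale e a f ann s =
  trans (Δᵥ-scale e a f s) (trans (cong (a ℚ.*_) (ann s)) (ℚₚ.*-zeroʳ a))

annihilates-shift : ∀ {m} (e : Vec ℕ m) c f → Annihilates e f → Annihilates e (λ s → f (s ℤ.+ c))
annihilates-shift e c f ann s = trans (Δᵥ-shift e c f s) (ann (s ℤ.+ c))

annihilates-Δ : ∀ {m} (e : Vec ℕ m) c f → Annihilates e f → Annihilates e (Δ c f)
annihilates-Δ e c f ann s = trans (Δᵥ-Δ e c f s) (cong₂ _-_ (ann s) (ann (s ℤ.- + c)))

annihilates-ΣFin : ∀ {m} (e : Vec ℕ m) n (t : Fin n → ℤ → ℚ) → (∀ i → Annihilates e (t i)) →
                   Annihilates e (λ s → ΣFin n (λ i → t i s))
annihilates-ΣFin e zero    t ann = annihilates-0 e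
annihilates-ΣFin e (suc n) t ann =
  annihilates-+ e (t Fin.zero) _ (ann Fin.zero) (annihilates-ΣFin e n (t ∘ Fin.suc) (ann ∘ Fin.suc))

annihilates-replicate-≤′ : ∀ {k k'} N f → k ≤′ k' → Annihilates (replicate k N) f →
                           Annihilates (replicate k' N) f
annihilates-replicate-≤′ N f ℕ.≤′-refl       ann = ann
annihilates-replicate-≤′ {k' = suc k'} N f (ℕ.≤′-step k≤k') ann =
  annihilates-Δ (replicate k' N) N f (annihilates-replicate-≤′ N f k≤k' ann)

Δ-mul-id : ∀ N f → Δ N (λ s → fromℤ s ℚ.* f s) ≗
           λ s → fromℤ s ℚ.* Δ N f s ℚ.+ fromℤ (+ N) ℚ.* f (s ℤ.- + N)
Δ-mul-id N f s = begin
    fromℤ s ℚ.* f s - fromℤ (s ℤ.- + N) ℚ.* f (s ℤ.- + N)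
      ≡⟨ cong (λ x → fromℤ s ℚ.* f s - x ℚ.* f (s ℤ.- + N)) (fromℤ-sub s (+ N)) ⟩
    fromℤ s ℚ.* f s - (fromℤ s - fromℤ (+ N)) ℚ.* f (s ℤ.- + N)
      ≡⟨ product-rule (fromℤ s) (fromℤ (+ N)) (f s) (f (s ℤ.- + N)) ⟩
    fromℤ s ℚ.* (f s - f (s ℤ.- + N)) ℚ.+ fromℤ (+ N) ℚ.* f (s ℤ.- + N) ∎
  where
  open ≡-Reasoning
  product-rule : ∀ x n a b → x ℚ.* a - (x - n) ℚ.* b ≡ x ℚ.* (a - b) ℚ.+ n ℚ.* b
  product-rule = solve-∀ ℚ-ring

annihilates-mul-id : ∀ k N f → Annihilates (replicate k N) f →
                     Annihilates (replicate (suc k) N) (λ s → fromℤ s ℚ.* f s)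
annihilates-mul-id k N f ann =
  annihilates-cong (replicate k N) (sym ∘ Δ-mul-id N f)
    (annihilates-+ (replicate k N) _ _ (mul-Δ k ann)
      (annihilates-scale (replicate k N) (fromℤ (+ N)) _
        (annihilates-shift (replicate k N) (ℤ.- + N) f ann)))
  where
  mul-Δ : ∀ k → Annihilates (replicate k N) f →
          Annihilates (replicate k N) (λ s → fromℤ s ℚ.* Δ N f s)
  mul-Δ zero    f≗0 s = trans (cong (λ x → fromℤ s ℚ.* x) (cong₂ _-_ (f≗0 s) (f≗0 (s ℤ.- + N))))
                              (ℚₚ.*-zeroʳ (fromℤ s))
  mul-Δ (suc k) ann = annihilates-mul-id k N (Δ N f) ann

HasPeriod : ℕ → (ℤ → ℚ) → Set
HasPeriod N c = ∀ s → c (s ℤ.+ + N) ≡ c s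

hasPeriod-∣ : ∀ {N P} c → N ∣ P → HasPeriod N c → HasPeriod P c
hasPeriod-∣ {N} c (divides q refl) per = multiple q
  where
  swap : ∀ s a b → s ℤ.+ (a ℤ.+ b) ≡ (s ℤ.+ b) ℤ.+ a
  swap = solve-∀ ℤ-ring
  multiple : ∀ q → HasPeriod (q * N) c
  multiple zero    s = cong c (ℤₚ.+-identityʳ s)
  multiple (suc q) s = trans (cong c (swap s (+ N) (+ (q * N)))) (trans (per _) (multiple q s))

Δ-period : ∀ {N} c → HasPeriod N c → Δ N c ≗ const 0ℚ
Δ-period {N} c per s = begin
    c s - c (s ℤ.- + N)
      ≡⟨ cong (λ u → c u - c (s ℤ.- + N)) (minus-plus s (+ N)) ⟨
    c ((s ℤ.- + N) ℤ.+ + N) - c (s ℤ.- + N)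
      ≡⟨ cong (_- c (s ℤ.- + N)) (per (s ℤ.- + N)) ⟩
    c (s ℤ.- + N) - c (s ℤ.- + N)
      ≡⟨ ℚₚ.+-inverseʳ (c (s ℤ.- + N)) ⟩
    0ℚ ∎
  where
  open ≡-Reasoning
  minus-plus : ∀ s n → (s ℤ.- n) ℤ.+ n ≡ s
  minus-plus = solve-∀ ℤ-ring

annihilates-monomial : ∀ N c → HasPeriod N c → ∀ j →
                       Annihilates (replicate (suc j) N) (λ s → c s ℚ.* (fromℤ s ^ j))
annihilates-monomial N c per zero    =
  annihilates-cong (replicate 1 N) (λ s → sym (ℚₚ.*-identityʳ (c s))) (Δ-period c per)
annihilates-monomial N c per (suc j) =
  annihilates-cong (replicate (suc (suc j)) N) (λ s → swap (fromℤ s) (c s) (fromℤ s ^ j))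
    (annihilates-mul-id (suc j) N _ (annihilates-monomial N c per j))
  where
  swap : ∀ x a b → x ℚ.* (a ℚ.* b) ≡ a ℚ.* (x ℚ.* b)
  swap = solve-∀ ℚ-ring

-- The product of the periods is a common period N, and the i-th term is killed by (Δ N)^(i+1).
quasiPoly-annihilated : ∀ m f → IsQuasiPoly m f → ∃[ N ] N > 0 × Annihilates (replicate m N) f
quasiPoly-annihilated m f (c , periodic , f≡) =
  N , >-nonZero⁻¹ N {{N≢0}} ,
  annihilates-cong (replicate m N) (sym ∘ f≡) (annihilates-ΣFin (replicate m N) m _ term)
  where
  period : Fin m → ℕ
  period i = proj₁ (periodic i)
  N : ℕ
  N = product (tabulate period)
  N≢0 : NonZero N
  N≢0 = product≢0 (tabulate⁺ (λ i → >-nonZero (proj₁ (proj₂ (periodic i)))))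
  term : ∀ i → Annihilates (replicate m N) (λ s → c i s ℚ.* (fromℤ s ^ toℕ i))
  term i = annihilates-replicate-≤′ N _ (ℕₚ.≤⇒≤′ (toℕ<n i))
             (annihilates-monomial N (c i)
               (hasPeriod-∣ (c i) (∈⇒∣product (∈-tabulate⁺ i)) (proj₂ (proj₂ (periodic i))))
               (toℕ i))

VanishesAbove : ℤ → (ℤ → ℚ) → Set
VanishesAbove t f = ∀ n → f (t ℤ.+ + suc n) ≡ 0ℚ

Δ-vanishesAbove : ∀ d t f → VanishesAbove t f → VanishesAbove (t ℤ.+ + d) (Δ d f)
Δ-vanishesAbove d t f vanishes n = begin
    f ((t ℤ.+ + d) ℤ.+ + suc n) - f (((t ℤ.+ + d) ℤ.+ + suc n) ℤ.- + d)
      ≡⟨ cong₂ (λ u v → f u - f v) (reassoc t (+ d) (+ n)) (cancel t (+ d) (+ suc n)) ⟩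
    f (t ℤ.+ + suc (d + n)) - f (t ℤ.+ + suc n)
      ≡⟨ cong₂ _-_ (vanishes (d + n)) (vanishes n) ⟩
    0ℚ ∎
  where
  open ≡-Reasoning
  reassoc : ∀ t d n → (t ℤ.+ d) ℤ.+ (+ 1 ℤ.+ n) ≡ t ℤ.+ (+ 1 ℤ.+ (d ℤ.+ n))
  reassoc = solve-∀ ℤ-ring
  cancel : ∀ t d n → ((t ℤ.+ d) ℤ.+ n) ℤ.- d ≡ t ℤ.+ n
  cancel = solve-∀ ℤ-ring

Δᵥ-vanishesAbove : ∀ {m} (e : Vec ℕ m) t f → VanishesAbove t f →
                   VanishesAbove (t ℤ.+ + vsum e) (Δᵥ e f)
Δᵥ-vanishesAbove []       t f vanishes n =
  trans (cong (λ u → f (u ℤ.+ + suc n)) (ℤₚ.+-identityʳ t)) (vanishes n)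
Δᵥ-vanishesAbove (d ∷ ds) t f vanishes n =
  trans (cong (λ u → Δᵥ ds (Δ d f) (u ℤ.+ + suc n)) (sym (ℤₚ.+-assoc t (+ d) (+ vsum ds))))
        (Δᵥ-vanishesAbove ds (t ℤ.+ + d) (Δ d f) (Δ-vanishesAbove d t f vanishes) n)

-- In the expansion of Δᵥ e f (t + Σ e), every term but ± f t is a value of f above t.
Δᵥ-at-edge : ∀ {m} (e : Vec ℕ m) → All (_> 0) e → ∀ t f → VanishesAbove t f →
             f t ≡ sign m ℚ.* Δᵥ e f (t ℤ.+ + vsum e)
Δᵥ-at-edge []       []         t f vanishes = begin
    f t                    ≡⟨ cong f (ℤₚ.+-identityʳ t) ⟨
    f (t ℤ.+ + 0)          ≡⟨ ℚₚ.*-identityˡ _ ⟨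
    1ℚ ℚ.* f (t ℤ.+ + 0)   ∎
  where open ≡-Reasoning
Δᵥ-at-edge {suc m} (suc d ∷ ds) (_ ∷ pos) t f vanishes = begin
    f t
      ≡⟨ edge ⟩
    - Δ (suc d) f (t ℤ.+ + suc d)
      ≡⟨ cong -_ (Δᵥ-at-edge ds pos _ (Δ (suc d) f) (Δ-vanishesAbove (suc d) t f vanishes)) ⟩
    - (sign m ℚ.* Δᵥ ds (Δ (suc d) f) ((t ℤ.+ + suc d) ℤ.+ + vsum ds))
      ≡⟨ ℚₚ.neg-distribˡ-* (sign m) _ ⟩
    sign (suc m) ℚ.* Δᵥ ds (Δ (suc d) f) ((t ℤ.+ + suc d) ℤ.+ + vsum ds)
      ≡⟨ cong (λ u → sign (suc m) ℚ.* Δᵥ ds (Δ (suc d) f) u) (ℤₚ.+-assoc t (+ suc d) (+ vsum ds)) ⟩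
    sign (suc m) ℚ.* Δᵥ (suc d ∷ ds) f (t ℤ.+ + vsum (suc d ∷ ds)) ∎
  where
  open ≡-Reasoning
  cancel : ∀ t d → (t ℤ.+ d) ℤ.- d ≡ t
  cancel = solve-∀ ℤ-ring
  neg-0- : ∀ x → x ≡ - (0ℚ - x)
  neg-0- = solve-∀ ℚ-ring
  edge : f t ≡ - Δ (suc d) f (t ℤ.+ + suc d)
  edge = trans (neg-0- (f t))
               (cong₂ (λ x u → - (x - f u)) (sym (vanishes d)) (sym (cancel t (+ suc d))))

vanishesAbove-pred : ∀ t f → VanishesAbove t f → f t ≡ 0ℚ → VanishesAbove (t ℤ.- + 1) f
vanishesAbove-pred t f vanishes ft≡0 zero    = trans (cong f (cancel t)) ft≡0
  where
  cancel : ∀ t → (t ℤ.- + 1) ℤ.+ + 1 ≡ t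
  cancel = solve-∀ ℤ-ring
vanishesAbove-pred t f vanishes ft≡0 (suc n) = trans (cong f (shift t (+ n))) (vanishes n)
  where
  shift : ∀ t n → (t ℤ.- + 1) ℤ.+ (+ 1 ℤ.+ (+ 1 ℤ.+ n)) ≡ t ℤ.+ (+ 1 ℤ.+ n)
  shift = solve-∀ ℤ-ring

-- Δᵥ-at-edge pushes the edge of the support down one step at a time.
annihilated-vanishesAbove⇒≗0 : ∀ {m} (e : Vec ℕ m) → All (_> 0) e → ∀ t f →
                        Annihilates e f → VanishesAbove t f → f ≗ const 0ℚ
annihilated-vanishesAbove⇒≗0 {m} e pos t f ann vanishes u =
  subst (λ v → f v ≡ 0ℚ) (t+[u-t]≡u t u) (from-t (u ℤ.- t))
  where
  t+[u-t]≡u : ∀ t u → t ℤ.+ (u ℤ.- t) ≡ u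
  t+[u-t]≡u = solve-∀ ℤ-ring
  pred-assoc : ∀ t n → (t ℤ.- n) ℤ.- + 1 ≡ t ℤ.- (+ 1 ℤ.+ n)
  pred-assoc = solve-∀ ℤ-ring
  edge : ∀ v → VanishesAbove v f → f v ≡ 0ℚ
  edge v vanishes-v = trans (Δᵥ-at-edge e pos v f vanishes-v)
                          (trans (cong (sign m ℚ.*_) (ann _)) (ℚₚ.*-zeroʳ (sign m)))
  down : ∀ n → VanishesAbove (t ℤ.- + n) f
  down zero    = subst (λ v → VanishesAbove v f) (sym (ℤₚ.+-identityʳ t)) vanishes
  down (suc n) = subst (λ v → VanishesAbove v f) (pred-assoc t (+ n))
                       (vanishesAbove-pred (t ℤ.- + n) f (down n) (edge _ (down n)))
  from-t : ∀ i → f (t ℤ.+ i) ≡ 0ℚ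
  from-t (+ zero)  = edge _ (down 0)
  from-t (+ suc n) = vanishes n
  from-t -[1+ n ]  = edge _ (down (suc n))

Δ-reflect : ∀ d a f → Δ d (λ s → f (a ℤ.- s)) ≗ λ s → - Δ d f ((a ℤ.+ + d) ℤ.- s)
Δ-reflect d a f s = begin
    f (a ℤ.- s) - f (a ℤ.- (s ℤ.- + d))
      ≡⟨ cong₂ (λ u v → f u - f v) (reflect₁ a (+ d) s) (reflect₂ a (+ d) s) ⟩
    f (((a ℤ.+ + d) ℤ.- s) ℤ.- + d) - f ((a ℤ.+ + d) ℤ.- s)
      ≡⟨ x-y≡-[y-x] (f (((a ℤ.+ + d) ℤ.- s) ℤ.- + d)) (f ((a ℤ.+ + d) ℤ.- s)) ⟩
    - Δ d f ((a ℤ.+ + d) ℤ.- s) ∎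
  where
  open ≡-Reasoning
  reflect₁ : ∀ a d s → a ℤ.- s ≡ ((a ℤ.+ d) ℤ.- s) ℤ.- d
  reflect₁ = solve-∀ ℤ-ring
  reflect₂ : ∀ a d s → a ℤ.- (s ℤ.- d) ≡ (a ℤ.+ d) ℤ.- s
  reflect₂ = solve-∀ ℤ-ring
  x-y≡-[y-x] : ∀ x y → x - y ≡ - (y - x)
  x-y≡-[y-x] = solve-∀ ℚ-ring

Δᵥ-reflect : ∀ {m} (e : Vec ℕ m) a f →
             Δᵥ e (λ s → f (a ℤ.- s)) ≗ λ s → sign m ℚ.* Δᵥ e f ((a ℤ.+ + vsum e) ℤ.- s)
Δᵥ-reflect []       a f s = begin
    f (a ℤ.- s)                       ≡⟨ cong (λ b → f (b ℤ.- s)) (ℤₚ.+-identityʳ a) ⟨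
    f ((a ℤ.+ + 0) ℤ.- s)             ≡⟨ ℚₚ.*-identityˡ _ ⟨
    1ℚ ℚ.* f ((a ℤ.+ + 0) ℤ.- s)      ∎
  where open ≡-Reasoning
Δᵥ-reflect {suc m} (d ∷ ds) a f s = begin
    Δᵥ ds (Δ d (λ s → f (a ℤ.- s))) s
      ≡⟨ Δᵥ-cong ds (Δ-reflect d a f) s ⟩
    Δᵥ ds (λ u → - Δ d f ((a ℤ.+ + d) ℤ.- u)) s
      ≡⟨ Δᵥ-neg ds (λ u → Δ d f ((a ℤ.+ + d) ℤ.- u)) s ⟩
    - Δᵥ ds (λ u → Δ d f ((a ℤ.+ + d) ℤ.- u)) s
      ≡⟨ cong -_ (Δᵥ-reflect ds (a ℤ.+ + d) (Δ d f) s) ⟩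
    - (sign m ℚ.* Δᵥ ds (Δ d f) (((a ℤ.+ + d) ℤ.+ + vsum ds) ℤ.- s))
      ≡⟨ ℚₚ.neg-distribˡ-* (sign m) _ ⟩
    sign (suc m) ℚ.* Δᵥ ds (Δ d f) (((a ℤ.+ + d) ℤ.+ + vsum ds) ℤ.- s)
      ≡⟨ cong (λ b → sign (suc m) ℚ.* Δᵥ ds (Δ d f) (b ℤ.- s)) (ℤₚ.+-assoc a (+ d) (+ vsum ds)) ⟩
    sign (suc m) ℚ.* Δᵥ (d ∷ ds) f ((a ℤ.+ + vsum (d ∷ ds)) ℤ.- s) ∎
  where open ≡-Reasoning

sum-applyUpTo-cong : ∀ {g h} n → (∀ x → g x ≡ h x) → sum (applyUpTo g n) ≡ sum (applyUpTo h n)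
sum-applyUpTo-cong zero    g≗h = refl
sum-applyUpTo-cong (suc n) g≗h = cong₂ _+_ (g≗h 0) (sum-applyUpTo-cong n (g≗h ∘ suc))

sum-applyUpTo-zero : ∀ g n → (∀ x → g x ≡ 0) → sum (applyUpTo g n) ≡ 0
sum-applyUpTo-zero g zero    g≗0 = refl
sum-applyUpTo-zero g (suc n) g≗0 = cong₂ _+_ (g≗0 0) (sum-applyUpTo-zero (g ∘ suc) n (g≗0 ∘ suc))

sum-applyUpTo-≤ : ∀ g {a n} → a ≤ n → (∀ x → a ≤ x → g x ≡ 0) →
                  sum (applyUpTo g n) ≡ sum (applyUpTo g a)
sum-applyUpTo-≤ g {zero}  {n}     a≤n       g≡0 = sum-applyUpTo-zero g n (λ x → g≡0 x z≤n)
sum-applyUpTo-≤ g {suc a} {suc n} (s≤s a≤n) g≡0 =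
  cong (λ r → g 0 + r) (sum-applyUpTo-≤ (g ∘ suc) a≤n (λ x a≤x → g≡0 (suc x) (s≤s a≤x)))

≤ᵇ-suc : ∀ m n → (suc m ≤ᵇ suc n) ≡ (m ≤ᵇ n)
≤ᵇ-suc zero    n = refl
≤ᵇ-suc (suc m) n = refl

≤ᵇ-+ : ∀ d m n → (d + m ≤ᵇ d + n) ≡ (m ≤ᵇ n)
≤ᵇ-+ zero    m n = refl
≤ᵇ-+ (suc d) m n = trans (≤ᵇ-suc (d + m) (d + n)) (≤ᵇ-+ d m n)

≤ᵇ-false : ∀ {m n} → n < m → (m ≤ᵇ n) ≡ false
≤ᵇ-false {m} {n} n<m = dec-false (m ℕ.≤? n) (ℕₚ.<⇒≱ n<m)

W-summand : ∀ {m} → ℕ → Vec ℕ m → ℕ → ℕ → ℕ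
W-summand d ds s x = if d * x ≤ᵇ s then W ds (s ∸ d * x) else 0

W-∷ : ∀ {m} d (ds : Vec ℕ m) s → W (d ∷ ds) s ≡ sum (applyUpTo (W-summand d ds s) (suc s))
W-∷ d ds s = cong sum (map-applyUpTo (λ x → x) (W-summand d ds s) (suc s))

W-summand-0 : ∀ {m} d (ds : Vec ℕ m) s → W-summand d ds s 0 ≡ W ds s
W-summand-0 d ds s rewrite ℕₚ.*-zeroʳ d = refl

W-summand-suc : ∀ {m} d (ds : Vec ℕ m) t x → W-summand d ds (d + t) (suc x) ≡ W-summand d ds t x
W-summand-suc d ds t x
  rewrite ℕₚ.*-suc d x | ≤ᵇ-+ d (d * x) t | ℕₚ.[m+n]∸[m+o]≡n∸o d t (d * x) = refl

W-summand-beyond : ∀ {m} d (ds : Vec ℕ m) {s} x → s < d * x → W-summand d ds s x ≡ 0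
W-summand-beyond d ds {s} x s<dx = cong (λ b → if b then W ds (s ∸ d * x) else 0) (≤ᵇ-false s<dx)

W-∷-< : ∀ {m} d (ds : Vec ℕ m) s → s < d → W (d ∷ ds) s ≡ W ds s
W-∷-< d ds s s<d = begin
    W (d ∷ ds) s
      ≡⟨ W-∷ d ds s ⟩
    sum (applyUpTo (W-summand d ds s) (suc s))
      ≡⟨ cong₂ _+_ (W-summand-0 d ds s) (sum-applyUpTo-zero _ s beyond) ⟩
    W ds s + 0
      ≡⟨ ℕₚ.+-identityʳ (W ds s) ⟩
    W ds s ∎
  where
  open ≡-Reasoning
  beyond : ∀ x → W-summand d ds s (suc x) ≡ 0
  beyond x = W-summand-beyond d ds (suc x) (ℕₚ.<-≤-trans s<d (ℕₚ.m≤m*n d (suc x)))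

W-∷-+ : ∀ {m} d (ds : Vec ℕ m) t → 0 < d → W (d ∷ ds) (d + t) ≡ W ds (d + t) + W (d ∷ ds) t
W-∷-+ d ds t 0<d = begin
    W (d ∷ ds) (d + t)
      ≡⟨ W-∷ d ds (d + t) ⟩
    sum (applyUpTo (W-summand d ds (d + t)) (suc (d + t)))
      ≡⟨ cong₂ _+_ (W-summand-0 d ds (d + t)) (sum-applyUpTo-cong (d + t) (W-summand-suc d ds t)) ⟩
    W ds (d + t) + sum (applyUpTo (W-summand d ds t) (d + t))
      ≡⟨ cong (λ r → W ds (d + t) + r) (sum-applyUpTo-≤ _ (ℕₚ.+-monoˡ-≤ t 0<d) beyond) ⟩
    W ds (d + t) + sum (applyUpTo (W-summand d ds t) (suc t))
      ≡⟨ cong (λ r → W ds (d + t) + r) (W-∷ d ds t) ⟨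
    W ds (d + t) + W (d ∷ ds) t ∎
  where
  open ≡-Reasoning
  beyond : ∀ x → suc t ≤ x → W-summand d ds t x ≡ 0
  beyond x t<x = W-summand-beyond d ds x (ℕₚ.<-≤-trans t<x (ℕₚ.m≤n*m x d {{>-nonZero 0<d}}))

W₀ : ∀ {m} → Vec ℕ m → ℤ → ℚ
W₀ d (+ n)    = fromℤ (+ W d n)
W₀ d -[1+ n ] = 0ℚ

δ : ℤ → ℚ
δ (+ zero)  = 1ℚ
δ (+ suc n) = 0ℚ
δ -[1+ n ]  = 0ℚ

δ-neg : ∀ s → δ (ℤ.- s) ≡ δ s
δ-neg (+ zero)  = refl
δ-neg (+ suc n) = refl
δ-neg -[1+ n ]  = refl

δ-vanishesAbove : ∀ a → VanishesAbove (+ a) δ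
δ-vanishesAbove a n rewrite ℕₚ.+-suc a n = refl

Δ-W₀-< : ∀ {m} d (ds : Vec ℕ m) n → n < d → Δ d (W₀ (d ∷ ds)) (+ n) ≡ W₀ ds (+ n)
Δ-W₀-< d ds n n<d with ℕₚ.m≤n⇒∃[o]m+o≡n n<d
... | k , refl = begin
    fromℤ (+ W (d ∷ ds) n) - W₀ (d ∷ ds) (+ n ℤ.- + d)
      ≡⟨ cong (λ z → fromℤ (+ W (d ∷ ds) n) - W₀ (d ∷ ds) z) (below (+ n) (+ k)) ⟩
    fromℤ (+ W (d ∷ ds) n) - 0ℚ
      ≡⟨ ℚₚ.+-identityʳ _ ⟩
    fromℤ (+ W (d ∷ ds) n)
      ≡⟨ cong (λ w → fromℤ (+ w)) (W-∷-< d ds n n<d) ⟩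
    fromℤ (+ W ds n) ∎
  where
  open ≡-Reasoning
  below : ∀ n k → n ℤ.- (+ 1 ℤ.+ (n ℤ.+ k)) ≡ ℤ.- (+ 1 ℤ.+ k)
  below = solve-∀ ℤ-ring

Δ-W₀-+ : ∀ {m} d (ds : Vec ℕ m) t → 0 < d → Δ d (W₀ (d ∷ ds)) (+ (d + t)) ≡ W₀ ds (+ (d + t))
Δ-W₀-+ d ds t 0<d = begin
    fromℤ (+ W (d ∷ ds) (d + t)) - W₀ (d ∷ ds) (+ (d + t) ℤ.- + d)
      ≡⟨ cong (λ z → fromℤ (+ W (d ∷ ds) (d + t)) - W₀ (d ∷ ds) z) (cancel (+ d) (+ t)) ⟩
    fromℤ (+ W (d ∷ ds) (d + t)) - fromℤ (+ W (d ∷ ds) t)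
      ≡⟨ cong (λ w → fromℤ (+ w) - fromℤ (+ W (d ∷ ds) t)) (W-∷-+ d ds t 0<d) ⟩
    fromℤ (+ W ds (d + t) ℤ.+ + W (d ∷ ds) t) - fromℤ (+ W (d ∷ ds) t)
      ≡⟨ cong (_- fromℤ (+ W (d ∷ ds) t)) (fromℤ-+ (+ W ds (d + t)) (+ W (d ∷ ds) t)) ⟩
    (fromℤ (+ W ds (d + t)) ℚ.+ fromℤ (+ W (d ∷ ds) t)) - fromℤ (+ W (d ∷ ds) t)
      ≡⟨ x+y-y≡x (fromℤ (+ W ds (d + t))) (fromℤ (+ W (d ∷ ds) t)) ⟩
    fromℤ (+ W ds (d + t)) ∎
  where
  open ≡-Reasoning
  cancel : ∀ d t → (d ℤ.+ t) ℤ.- d ≡ t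
  cancel = solve-∀ ℤ-ring
  x+y-y≡x : ∀ x y → (x ℚ.+ y) - y ≡ x
  x+y-y≡x = solve-∀ ℚ-ring

Δ-W₀ : ∀ {m} d (ds : Vec ℕ m) → 0 < d → Δ d (W₀ (d ∷ ds)) ≗ W₀ ds
Δ-W₀ (suc d) ds _ -[1+ n ] = refl
Δ-W₀ d ds 0<d (+ n) with n ℕ.<? d
... | yes n<d = Δ-W₀-< d ds n n<d
... | no n≮d with ℕₚ.m≤n⇒∃[o]m+o≡n (ℕₚ.≮⇒≥ n≮d)
...   | t , refl = Δ-W₀-+ d ds t 0<d

Δᵥ-W₀ : ∀ {m} (d : Vec ℕ m) → All (_> 0) d → Δᵥ d (W₀ d) ≗ δ
Δᵥ-W₀ []       []          (+ zero)  = refl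
Δᵥ-W₀ []       []          (+ suc n) = refl
Δᵥ-W₀ []       []          -[1+ n ]  = refl
Δᵥ-W₀ (d ∷ ds) (0<d ∷ pos) s         = trans (Δᵥ-cong ds (Δ-W₀ d ds 0<d) s) (Δᵥ-W₀ ds pos s)

All-replicate : ∀ {P : ℕ → Set} k {x} → P x → All P (replicate k x)
All-replicate zero    px = []
All-replicate (suc k) px = px ∷ All-replicate k px

annihilates-W̃ : ∀ {m} (d : Vec ℕ m) → All (_> 0) d → ∀ Wt → IsWtilde d Wt → Annihilates d Wt
annihilates-W̃ {m} d pos Wt (quasiPoly , Wt≡W) with quasiPoly-annihilated m Wt quasiPoly
... | N , N>0 , ann-N =
  annihilated-vanishesAbove⇒≗0 (replicate m N) (All-replicate m N>0) (+ vsum d) (Δᵥ d Wt) ann-N-Δᵥ vanishes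
  where
  ann-N-Δᵥ : Annihilates (replicate m N) (Δᵥ d Wt)
  ann-N-Δᵥ s = trans (Δᵥ-comm d (replicate m N) Wt s)
                     (annihilates-cong d (sym ∘ ann-N) (annihilates-0 d) s)
  error : ℤ → ℚ
  error s = Wt s - W₀ d s
  error-vanishes : VanishesAbove (+ 0) error
  error-vanishes n =
    trans (cong (_- W₀ d (+ suc n)) (Wt≡W (suc n))) (ℚₚ.+-inverseʳ (W₀ d (+ suc n)))
  x≡[x-y]+y : ∀ x y → x ≡ (x - y) ℚ.+ y
  x≡[x-y]+y = solve-∀ ℚ-ring
  vanishes : VanishesAbove (+ vsum d) (Δᵥ d Wt)
  vanishes n = begin
      Δᵥ d Wt u
        ≡⟨ x≡[x-y]+y (Δᵥ d Wt u) (Δᵥ d (W₀ d) u) ⟩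
      (Δᵥ d Wt u - Δᵥ d (W₀ d) u) ℚ.+ Δᵥ d (W₀ d) u
        ≡⟨ cong₂ ℚ._+_ (sym (Δᵥ-sub d Wt (W₀ d) u)) (Δᵥ-W₀ d pos u) ⟩
      Δᵥ d error u ℚ.+ δ u
        ≡⟨ cong₂ ℚ._+_ (Δᵥ-vanishesAbove d (+ 0) error error-vanishes n)
                       (δ-vanishesAbove (vsum d) n) ⟩
      0ℚ ∎
    where
    open ≡-Reasoning
    u = + vsum d ℤ.+ + suc n

W₀-reflected-vanishes : ∀ {m} (d : Vec ℕ m) a n → W₀ d ((ℤ.- + a) ℤ.- + suc n) ≡ 0ℚ
W₀-reflected-vanishes d zero    n = refl
W₀-reflected-vanishes d (suc a) n = refl

-- Under Δᵥ d the two parts of the right side become δ and sign m ² δ.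
W̃-formula : ∀ {m} (d : Vec ℕ m) → All (_> 0) d → ∀ Wt → IsWtilde d Wt →
            ∀ s → Wt s ≡ W₀ d s - sign m ℚ.* W₀ d ((ℤ.- + vsum d) ℤ.- s)
W̃-formula {m} d pos Wt Wt-is-W̃ s =
  x-y≡0⇒x≡y _ _ (annihilated-vanishesAbove⇒≗0 d pos (+ 0) error ann-error error-vanishes s)
  where
  a = ℤ.- + vsum d
  W₀ᵣ : ℤ → ℚ
  W₀ᵣ s = W₀ d (a ℤ.- s)
  error : ℤ → ℚ
  error s = Wt s - (W₀ d s - sign m ℚ.* W₀ᵣ s)
  [-v+v]-s≡-s : ∀ v s → ((ℤ.- v) ℤ.+ v) ℤ.- s ≡ ℤ.- s
  [-v+v]-s≡-s = solve-∀ ℤ-ring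
  Δᵥ-W₀ᵣ : ∀ s → Δᵥ d W₀ᵣ s ≡ sign m ℚ.* δ s
  Δᵥ-W₀ᵣ s = trans (Δᵥ-reflect d a (W₀ d) s) (cong (sign m ℚ.*_)
    (trans (Δᵥ-W₀ d pos _) (trans (cong δ ([-v+v]-s≡-s (+ vsum d) s)) (δ-neg s))))
  ann-error : Annihilates d error
  ann-error s = begin
      Δᵥ d error s
        ≡⟨ Δᵥ-sub d Wt _ s ⟩
      Δᵥ d Wt s - Δᵥ d (λ u → W₀ d u - sign m ℚ.* W₀ᵣ u) s
        ≡⟨ cong₂ _-_ (annihilates-W̃ d pos Wt Wt-is-W̃ s) (Δᵥ-sub d (W₀ d) _ s) ⟩
      0ℚ - (Δᵥ d (W₀ d) s - Δᵥ d (λ u → sign m ℚ.* W₀ᵣ u) s)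
        ≡⟨ cong (λ x → 0ℚ - (Δᵥ d (W₀ d) s - x)) (Δᵥ-scale d (sign m) W₀ᵣ s) ⟩
      0ℚ - (Δᵥ d (W₀ d) s - sign m ℚ.* Δᵥ d W₀ᵣ s)
        ≡⟨ cong₂ (λ x y → 0ℚ - (x - sign m ℚ.* y)) (Δᵥ-W₀ d pos s) (Δᵥ-W₀ᵣ s) ⟩
      0ℚ - (δ s - sign m ℚ.* (sign m ℚ.* δ s))
        ≡⟨ cong (λ x → 0ℚ - (δ s - x)) (sign-sign-* m (δ s)) ⟩
      0ℚ - (δ s - δ s)
        ≡⟨ cong (λ x → 0ℚ - x) (ℚₚ.+-inverseʳ (δ s)) ⟩
      0ℚ ∎
    where open ≡-Reasoning
  x-[x-σ0]≡0 : ∀ x σ → x - (x - σ ℚ.* 0ℚ) ≡ 0ℚ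
  x-[x-σ0]≡0 = solve-∀ ℚ-ring
  error-vanishes : VanishesAbove (+ 0) error
  error-vanishes n =
    trans (cong₂ (λ x y → x - (W₀ d (+ suc n) - sign m ℚ.* y))
                 (proj₂ Wt-is-W̃ (suc n)) (W₀-reflected-vanishes d (vsum d) n))
          (x-[x-σ0]≡0 (W₀ d (+ suc n)) (sign m))

W̃-reciprocity : ∀ {m} (d : Vec ℕ m) → All (_> 0) d → ∀ Wt → IsWtilde d Wt →
                ∀ s → Wt s ≡ - (sign m ℚ.* Wt ((ℤ.- + vsum d) ℤ.- s))
W̃-reciprocity {m} d pos Wt Wt-is-W̃ s = begin
    Wt s
      ≡⟨ W̃-formula d pos Wt Wt-is-W̃ s ⟩
    W₀ d s - σ ℚ.* W₀ d s'
      ≡⟨ cong (λ x → x - σ ℚ.* W₀ d s') (sign-sign-* m (W₀ d s)) ⟨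
    σ ℚ.* (σ ℚ.* W₀ d s) - σ ℚ.* W₀ d s'
      ≡⟨ regroup σ (W₀ d s) (W₀ d s') ⟩
    - (σ ℚ.* (W₀ d s' - σ ℚ.* W₀ d s))
      ≡⟨ cong (λ z → - (σ ℚ.* (W₀ d s' - σ ℚ.* W₀ d z))) (a-[a-s]≡s a s) ⟨
    - (σ ℚ.* (W₀ d s' - σ ℚ.* W₀ d (a ℤ.- s')))
      ≡⟨ cong (λ x → - (σ ℚ.* x)) (W̃-formula d pos Wt Wt-is-W̃ s') ⟨
    - (σ ℚ.* Wt s') ∎
  where
  open ≡-Reasoning
  σ = sign m
  a = ℤ.- + vsum d
  s' = a ℤ.- s
  regroup : ∀ σ x y → σ ℚ.* (σ ℚ.* x) - σ ℚ.* y ≡ - (σ ℚ.* (y - σ ℚ.* x))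
  regroup = solve-∀ ℚ-ring
  a-[a-s]≡s : ∀ a s → a ℤ.- (a ℤ.- s) ≡ s
  a-[a-s]≡s = solve-∀ ℤ-ring

lemma4p1 : (m : ℕ) → m ≥ 1 → (d : Vec ℕ m) → All (_> 0) d →
    (Wt : ℤ → ℚ) → IsWtilde d Wt →
    -- V(s) = Wt(k) where s - ξ = k, V(-s) = Wt(k') where -s - ξ = k'
    (s : ℚ) (k k' : ℤ) → s - ξ d ≡ fromℤ k → (- s) - ξ d ≡ fromℤ k' →
      ((∃[ j ] m ≡ 2 * j) → Wt k ≡ - Wt k')
      × ((∃[ j ] m ≡ 1 + 2 * j) → Wt k ≡ Wt k')
lemma4p1 m _ d pos Wt Wt-is-W̃ s k k' s-ξ≡k -s-ξ≡k' = even , odd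
  where
  reciprocity : Wt k ≡ - (sign m ℚ.* Wt k')
  reciprocity = trans (W̃-reciprocity d pos Wt Wt-is-W̃ k)
                      (cong (λ z → - (sign m ℚ.* Wt z)) (sym (ξ-reflection d {s} s-ξ≡k -s-ξ≡k')))
  -1*-neg : ∀ x → - (- 1ℚ ℚ.* x) ≡ x
  -1*-neg = solve-∀ ℚ-ring
  even : (∃[ j ] m ≡ 2 * j) → Wt k ≡ - Wt k'
  even (j , m≡2j) = trans reciprocity
    (cong -_ (trans (cong (ℚ._* Wt k') (sign-even j m≡2j)) (ℚₚ.*-identityˡ (Wt k'))))
  odd : (∃[ j ] m ≡ 1 + 2 * j) → Wt k ≡ Wt k'
  odd (j , m≡1+2j) = trans reciprocity
    (trans (cong (λ σ → - (σ ℚ.* Wt k')) (sign-odd j m≡1+2j)) (-1*-neg (Wt k')))
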